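{- Let $\lambda/\mu$ and $\nu/\tau$ be skew shapes and $\mathbf{w}$ an integer composition. Then $\mathcal{P}_{(\lambda/\mu)\cup(\nu/\tau),\mathbf{w}}$ is integral if and only if $\mathcal{P}_{(\nu/\tau)\cup(\lambda/\mu),\mathbf{w}}$ is integral.
   Context: Skew shapes $\lambda/\mu$ are pairs of integer partitions with $\lambda_i\ge\mu_i$ for all $i$, with $\mu$ padded with zeros to the length of $\lambda$. The disjoint union of skew shapes is $(\lambda/\mu)\cup(\nu/\tau)=(\nu_1+\lambda,\nu)/(\nu_1+\mu,\tau)$, where $\nu_1+\lambda$ denotes adding $\nu_1$ to each of the $\ell(\lambda)$ parts of $\lambda$ (and $\nu_1+\mu$ adding $\nu_1$ to each of the $\ell(\lambda)$ parts of the padded $\mu$), and the comma denotes concatenation; e.g. $(3,2)/(1)\cup(4,2,2)/(1,1)=(7,6,4,2,2)/(5,4,1,1)$. For a composition $\mathbf{w}=(w_1,\dots,w_{m-1})$, a Gelfand--Tsetlin pattern is a real array $(x^i_j)_{1\le i\le m,\,1\le j\le n}$ with $x^{i+1}_j\ge x^i_j$ and $x^i_j\ge x^{i+1}_{j+1}$ whenever defined; $\mathcal{P}_{\alpha/\beta,\mathbf{w}}\subset\mathbb{R}^{mn}$ is the polytope of such patterns with $\mathbf{x}^m=\alpha$, $\mathbf{x}^1=\beta$, and $\sum_jx^{i+1}_j-\sum_jx^i_j=w_i$ for all $i$. A polytope is integral if all its vertices are lattice points.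
   Formalization: The polytopes $\mathcal{P}_{\alpha/\beta,\mathbf{w}}$ and their vertices are taken in ℚ^(mn) instead of $\mathbb{R}^{mn}$. -}

module Defs where

open import Data.Nat as ℕ using (ℕ; zero; suc)
open import Data.Integer as ℤ using (ℤ)
open import Data.Rational as ℚ using (ℚ; 0ℚ; ½)
open import Data.List using (List; []; _∷_; length; map; foldr; _++_; allFin; replicate)
open import Data.List.Relation.Unary.All using (All)
open import Data.List.Relation.Unary.Linked using (Linked)
open import Data.List.Relation.Binary.Pointwise using (Pointwise)
open import Data.Fin using (Fin; zero; suc; inject₁; fromℕ; toℕ)
open import Data.Product using (Σ; ∃; _×_; _,_)
open import Relation.Binary.PropositionalEquality using (_≡_)

IsPartition : List ℕ → Set
IsPartition λ′ = Linked (λ a b → b ℕ.≤ a) λ′ × All (λ a → 1 ℕ.≤ a) λ′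

pad : List ℕ → ℕ → List ℕ
pad xs zero = xs
pad [] (suc k) = 0 ∷ pad [] k
pad (x ∷ xs) (suc k) = x ∷ pad xs k

record SkewShape : Set where
  constructor _/_⟨_,_,_,_⟩
  field
    outer : List ℕ
    inner : List ℕ
    outerPartition : IsPartition outer
    innerPartition : IsPartition inner
    innerShorter   : length inner ℕ.≤ length outer
    contained      : Pointwise ℕ._≤_ (pad inner (length outer)) outer
open SkewShape public

head0 : List ℕ → ℕ
head0 [] = 0
head0 (x ∷ _) = x

-- (λ/μ) ∪ (ν/τ) = (ν₁+λ, ν) / (ν₁+μ, τ), μ padded to length ℓ(λ).
-- Only the pair (outer, inner) of lists is needed for the polytope.
unionOuter : SkewShape → SkewShape → List ℕ
unionOuter s t = map (head0 (outer t) ℕ.+_) (outer s) ++ outer t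

unionInner : SkewShape → SkewShape → List ℕ
unionInner s t =
  map (head0 (outer t) ℕ.+_) (pad (inner s) (length (outer s))) ++ inner t

-- entry j of a list, 0 if out of range (used for the zero-padding of β)
at : List ℕ → ℕ → ℕ
at [] _ = 0
at (x ∷ xs) zero = x
at (x ∷ xs) (suc j) = at xs j

ℕ→ℚ : ℕ → ℚ
ℕ→ℚ k = ℤ.+ k ℚ./ 1

-- An array x^i_j, rows i ∈ {1..m} (as Fin m), columns j ∈ {1..n} (as Fin n).
Array : ℕ → ℕ → Set
Array m n = Fin m → Fin n → ℚ

rowSum : ∀ {m n} → Array m n → Fin m → ℚ
rowSum {n = n} x i = foldr ℚ._+_ 0ℚ (map (x i) (allFin n))

-- Membership in P_{α/β,w}: here m = length w + 1, n = length α,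
-- row 1 = zero, row m = fromℕ (length w), row i = inject₁ i, row i+1 = suc i.
record InGT (α β w : List ℕ) (x : Array (suc (length w)) (length α)) : Set where
  field
    up   : ∀ (i : Fin (length w)) (j : Fin (length α)) →
             x (inject₁ i) j ℚ.≤ x (suc i) j
    diag : ∀ (i : Fin (length w)) (j : Fin (length α)) (j′ : Fin (length α)) →
             toℕ j′ ≡ suc (toℕ j) → x (suc i) j′ ℚ.≤ x (inject₁ i) j
    top  : ∀ (j : Fin (length α)) → x (fromℕ (length w)) j ≡ ℕ→ℚ (at α (toℕ j))
    bot  : ∀ (j : Fin (length α)) → x zero j ≡ ℕ→ℚ (at β (toℕ j))
    sums : ∀ (i : Fin (length w)) →
             rowSum x (suc i) ℚ.- rowSum x (inject₁ i) ≡ ℕ→ℚ (at w (toℕ i))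

IsVertex : (α β w : List ℕ) → Array (suc (length w)) (length α) → Set
IsVertex α β w x =
  InGT α β w x ×
  (∀ y z → InGT α β w y → InGT α β w z →
     (∀ i j → x i j ≡ (y i j ℚ.+ z i j) ℚ.* ½) →
     ∀ i j → y i j ≡ z i j)

IsIntegral : (α β w : List ℕ) → Set
IsIntegral α β w =
  ∀ x → IsVertex α β w x → ∀ i j → ∃ λ (k : ℤ) → x i j ≡ k ℚ./ 1

-- Columns 1, …, ℓ(λ) of a pattern in P_{(λ/μ)∪(ν/τ),w} form the λ-block raised by ν₁, the
-- remaining columns the ν-block. Putting the ν-block first, lowering the λ-block by ν₁ and
-- raising the ν-block by λ₁ is a lattice-preserving affine bijection onto P_{(ν/τ)∪(λ/μ),w}:
-- row sums change by a constant, interlacing inside a block is untouched, and the new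
-- interlacing inequality at the seam between the blocks holds automatically because all
-- entries are nonnegative and those of the raised λ-block are at most ν₁ + λ₁. Such a
-- bijection maps vertices to vertices, so integrality is transferred.

{-# OPTIONS --safe #-}
module Submission where

open import Defs
open import Data.Nat using (ℕ)
open import Data.List using (List)
open import Function.Bundles using (_⇔_; mk⇔)

open import Data.Nat as ℕ using (zero; suc; z≤n; s≤s)
import Data.Nat.Properties as ℕP
open import Data.Nat.Coprimality using (1-coprimeTo) renaming (sym to coprime-sym)
open import Data.Integer as ℤ using (ℤ; +_)
import Data.Integer.Properties as ℤP
open import Data.Integer.Tactic.RingSolver using (solve-∀)
open import Data.Rational as ℚ using (ℚ; 0ℚ; ½; mkℚ)
import Data.Rational.Properties as ℚP
open import Data.Rational.Solver using (module +-*-Solver)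
open import Data.List using ([]; _∷_; _++_; length; map)
import Data.List as List
import Data.List.Properties as ListP
open import Data.Fin using (Fin; zero; suc; inject₁; fromℕ; toℕ; fromℕ<)
import Data.Fin.Properties as FinP
open import Data.Fin.Permutation using (Permutation; _⟨$⟩ʳ_; _⟨$⟩ˡ_; flip; inverseʳ; permutation)
import Data.Vec.Functional as Vector
open import Algebra.Properties.CommutativeMonoid.Sum ℚP.+-0-commutativeMonoid
  using (sum; sum-permute; ∑-distrib-+)
open import Data.Product using (∃; _×_; _,_)
open import Function using (_∘_)
open import Relation.Binary.PropositionalEquality
open import Relation.Nullary using (yes; no)
open import Relation.Nullary.Negation using (contradiction)

IsInteger : ℚ → Set
IsInteger q = ∃ λ (k : ℤ) → q ≡ k ℚ./ 1

/1≡mkℚ : ∀ k → k ℚ./ 1 ≡ mkℚ k 0 (coprime-sym (1-coprimeTo ℤ.∣ k ∣))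
/1≡mkℚ k = ℚP.↥p/↧p≡p (mkℚ k 0 (coprime-sym (1-coprimeTo ℤ.∣ k ∣)))

/1-homo-+ : ∀ k m → k ℚ./ 1 ℚ.+ m ℚ./ 1 ≡ (k ℤ.+ m) ℚ./ 1
/1-homo-+ k m rewrite /1≡mkℚ k | /1≡mkℚ m =
  cong (ℚ._/ 1) (cong₂ ℤ._+_ (ℤP.*-identityʳ k) (ℤP.*-identityʳ m))

0≤ℕ→ℚ : ∀ n → 0ℚ ℚ.≤ ℕ→ℚ n
0≤ℕ→ℚ n rewrite /1≡mkℚ (+ n) = ℚP.nonNegative⁻¹ _

crossing-offsets : ∀ a b {u v} → u ℚ.≤ ℕ→ℚ (a ℕ.+ b) → 0ℚ ℚ.≤ v →
                   u ℚ.+ (+ 0 ℤ.- + a) ℚ./ 1 ℚ.≤ v ℚ.+ (+ b ℤ.- + 0) ℚ./ 1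
crossing-offsets a b {u} {v} u≤a+b 0≤v = begin
  u ℚ.+ (+ 0 ℤ.- + a) ℚ./ 1                   ≤⟨ ℚP.+-monoˡ-≤ _ u≤a+b ⟩
  ℕ→ℚ (a ℕ.+ b) ℚ.+ (+ 0 ℤ.- + a) ℚ./ 1       ≡⟨ /1-homo-+ (+ (a ℕ.+ b)) (+ 0 ℤ.- + a) ⟩
  (+ a ℤ.+ + b ℤ.+ (+ 0 ℤ.- + a)) ℚ./ 1       ≡⟨ cong (ℚ._/ 1) (cancel (+ a) (+ b)) ⟩
  (+ b ℤ.- + 0) ℚ./ 1                         ≡⟨ ℚP.+-identityˡ _ ⟨
  0ℚ ℚ.+ (+ b ℤ.- + 0) ℚ./ 1                  ≤⟨ ℚP.+-monoˡ-≤ _ 0≤v ⟩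
  v ℚ.+ (+ b ℤ.- + 0) ℚ./ 1                   ∎
  where
    open ℚP.≤-Reasoning
    cancel : ∀ a b → a ℤ.+ b ℤ.+ (ℤ.0ℤ ℤ.- a) ≡ b ℤ.- ℤ.0ℤ
    cancel = solve-∀

-- ½ + ½ reduces to 1, so the solver may read c as c * (½ + ½).
+-distrib-midpoint : ∀ u v c → (u ℚ.+ v) ℚ.* ½ ℚ.+ c ≡ ((u ℚ.+ c) ℚ.+ (v ℚ.+ c)) ℚ.* ½
+-distrib-midpoint u v c = begin
  (u ℚ.+ v) ℚ.* ½ ℚ.+ c           ≡⟨ cong ((u ℚ.+ v) ℚ.* ½ ℚ.+_) (sym (ℚP.*-identityʳ c)) ⟩
  (u ℚ.+ v) ℚ.* ½ ℚ.+ c ℚ.* ℚ.1ℚ  ≡⟨ solve 4 (λ u v c h → (u :+ v) :* h :+ c :* (h :+ h) :=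
                                                       ((u :+ c) :+ (v :+ c)) :* h) refl u v c ½ ⟩
  ((u ℚ.+ c) ℚ.+ (v ℚ.+ c)) ℚ.* ½ ∎
  where open ≡-Reasoning; open +-*-Solver

foldr-tabulate : ∀ {A B : Set} (f : A → B → B) e {n} (g : Fin n → A) →
                 List.foldr f e (List.tabulate g) ≡ Vector.foldr f e g
foldr-tabulate f e {zero}  g = refl
foldr-tabulate f e {suc n} g = cong (f (g zero)) (foldr-tabulate f e (λ j → g (suc j)))

rowSum≡sum : ∀ {m n} (x : Array m n) r → rowSum x r ≡ sum (x r)
rowSum≡sum x r = trans (cong (List.foldr ℚ._+_ 0ℚ) (ListP.map-tabulate (λ j → j) (x r)))
                               (foldr-tabulate ℚ._+_ 0ℚ (x r))

-- Relabelling the columns of an array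

-- Columns are permuted by π and the offset o of each column replaced by o′.
module _ {n n′ : ℕ} (π : Permutation n′ n) (o : Fin n → ℕ) (o′ : Fin n′ → ℕ) where

  shift : Fin n′ → ℤ
  shift j = + o′ j ℤ.- + o (π ⟨$⟩ʳ j)

  relabel : ∀ {m} → Array m n → Array m n′
  relabel x i j = x i (π ⟨$⟩ʳ j) ℚ.+ shift j ℚ./ 1

  module _ {m : ℕ} where

    relabel-cong : (x y : Array m n) → (∀ i j → x i j ≡ y i j) → ∀ i j → relabel x i j ≡ relabel y i j
    relabel-cong x y x≡y i j = cong (ℚ._+ shift j ℚ./ 1) (x≡y i (π ⟨$⟩ʳ j))

    relabel-midpoint : (x y z : Array m n) → (∀ i j → x i j ≡ (y i j ℚ.+ z i j) ℚ.* ½) →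
                       ∀ i j → relabel x i j ≡ (relabel y i j ℚ.+ relabel z i j) ℚ.* ½
    relabel-midpoint x y z mid i j =
      trans (cong (ℚ._+ shift j ℚ./ 1) (mid i (π ⟨$⟩ʳ j)))
            (+-distrib-midpoint (y i (π ⟨$⟩ʳ j)) (z i (π ⟨$⟩ʳ j)) (shift j ℚ./ 1))

    relabel-integral : (x : Array m n) → (∀ i j → IsInteger (x i j)) → ∀ i j → IsInteger (relabel x i j)
    relabel-integral x int i j with int i (π ⟨$⟩ʳ j)
    ... | k , eq = k ℤ.+ shift j , trans (cong (ℚ._+ shift j ℚ./ 1) eq) (/1-homo-+ k (shift j))

    relabel-mono : (x : Array m n) {r r′ : Fin m} {j j′ : Fin n′} →
                   x r (π ⟨$⟩ʳ j) ℚ.≤ x r′ (π ⟨$⟩ʳ j′) → shift j ≡ shift j′ →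
                   relabel x r j ℚ.≤ relabel x r′ j′
    relabel-mono x {j′ = j′} le eq rewrite eq = ℚP.+-monoˡ-≤ (shift j′ ℚ./ 1) le

    relabel-fixedRow : (x : Array m n) (r : Fin m) (d : Fin n → ℕ) → (∀ j → x r j ≡ ℕ→ℚ (o j ℕ.+ d j)) →
                       ∀ j → relabel x r j ≡ ℕ→ℚ (o′ j ℕ.+ d (π ⟨$⟩ʳ j))
    relabel-fixedRow x r d row j = begin
      x r (π ⟨$⟩ʳ j) ℚ.+ shift j ℚ./ 1          ≡⟨ cong (ℚ._+ shift j ℚ./ 1) (row (π ⟨$⟩ʳ j)) ⟩
      ℕ→ℚ (p ℕ.+ q) ℚ.+ shift j ℚ./ 1          ≡⟨ /1-homo-+ (+ (p ℕ.+ q)) (shift j) ⟩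
      (+ p ℤ.+ + q ℤ.+ (+ p′ ℤ.- + p)) ℚ./ 1   ≡⟨ cong (ℚ._/ 1) (offset-exchange (+ p) (+ q) (+ p′)) ⟩
      ℕ→ℚ (p′ ℕ.+ q) ∎
      where
        open ≡-Reasoning
        p = o (π ⟨$⟩ʳ j)
        p′ = o′ j
        q = d (π ⟨$⟩ʳ j)
        offset-exchange : ∀ a b c → a ℤ.+ b ℤ.+ (c ℤ.- a) ≡ c ℤ.+ b
        offset-exchange = solve-∀

    rowSum-relabel : (x : Array m n) (r : Fin m) →
                     rowSum (relabel x) r ≡ rowSum x r ℚ.+ sum (λ j → shift j ℚ./ 1)
    rowSum-relabel x r = begin
      rowSum (relabel x) r
        ≡⟨ rowSum≡sum (relabel x) r ⟩
      sum (λ j → x r (π ⟨$⟩ʳ j) ℚ.+ shift j ℚ./ 1)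
        ≡⟨ ∑-distrib-+ (λ j → x r (π ⟨$⟩ʳ j)) _ ⟩
      sum (λ j → x r (π ⟨$⟩ʳ j)) ℚ.+ sum (λ j → shift j ℚ./ 1)
        ≡⟨ cong (ℚ._+ _) (sum-permute (x r) π) ⟨
      sum (x r) ℚ.+ sum (λ j → shift j ℚ./ 1)
        ≡⟨ cong (ℚ._+ _) (rowSum≡sum x r) ⟨
      rowSum x r ℚ.+ sum (λ j → shift j ℚ./ 1)
        ∎
      where open ≡-Reasoning

    rowSum-relabel-difference : (x : Array m n) (r r′ : Fin m) →
      rowSum (relabel x) r ℚ.- rowSum (relabel x) r′ ≡ rowSum x r ℚ.- rowSum x r′
    rowSum-relabel-difference x r r′ =
      trans (cong₂ ℚ._-_ (rowSum-relabel x r) (rowSum-relabel x r′))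
            (solve 3 (λ a b c → (a :+ c) :- (b :+ c) := a :- b) refl (rowSum x r) (rowSum x r′) _)
      where open +-*-Solver

relabel-inverse : ∀ {m n n′} (π : Permutation n′ n) (o : Fin n → ℕ) (o′ : Fin n′ → ℕ) (x : Array m n) →
                  ∀ i j → relabel (flip π) o′ o (relabel π o o′ x) i j ≡ x i j
relabel-inverse π o o′ x i j = begin
  x i (π ⟨$⟩ʳ k) ℚ.+ (+ o′ k ℤ.- + o (π ⟨$⟩ʳ k)) ℚ./ 1 ℚ.+ (+ o j ℤ.- + o′ k) ℚ./ 1
    ≡⟨ cong (λ l → x i l ℚ.+ (+ o′ k ℤ.- + o l) ℚ./ 1 ℚ.+ (+ o j ℤ.- + o′ k) ℚ./ 1) (inverseʳ π) ⟩
  x i j ℚ.+ (+ o′ k ℤ.- + o j) ℚ./ 1 ℚ.+ (+ o j ℤ.- + o′ k) ℚ./ 1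
    ≡⟨ ℚP.+-assoc (x i j) _ _ ⟩
  x i j ℚ.+ ((+ o′ k ℤ.- + o j) ℚ./ 1 ℚ.+ (+ o j ℤ.- + o′ k) ℚ./ 1)
    ≡⟨ cong (x i j ℚ.+_) (/1-homo-+ (+ o′ k ℤ.- + o j) (+ o j ℤ.- + o′ k)) ⟩
  x i j ℚ.+ (+ o′ k ℤ.- + o j ℤ.+ (+ o j ℤ.- + o′ k)) ℚ./ 1
    ≡⟨ cong (λ d → x i j ℚ.+ d ℚ./ 1) (opposite-differences (+ o′ k) (+ o j)) ⟩
  x i j ℚ.+ 0ℚ
    ≡⟨ ℚP.+-identityʳ (x i j) ⟩
  x i j ∎
  where
    open ≡-Reasoning
    k = π ⟨$⟩ˡ j
    opposite-differences : ∀ a b → a ℤ.- b ℤ.+ (b ℤ.- a) ≡ ℤ.0ℤ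
    opposite-differences = solve-∀

IsExtreme : ∀ {m n} → (Array m n → Set) → Array m n → Set
IsExtreme P x =
  P x × (∀ y z → P y → P z → (∀ i j → x i j ≡ (y i j ℚ.+ z i j) ℚ.* ½) → ∀ i j → y i j ≡ z i j)

ExtremePointsIntegral : ∀ {m n} → (Array m n → Set) → Set
ExtremePointsIntegral P = ∀ x → IsExtreme P x → ∀ i j → IsInteger (x i j)

relabel-transfers-integrality :
  ∀ {m n n′} (π : Permutation n′ n) (o : Fin n → ℕ) (o′ : Fin n′ → ℕ)
  {P : Array m n → Set} {Q : Array m n′ → Set} →
  (∀ x → P x → Q (relabel π o o′ x)) → (∀ y → Q y → P (relabel (flip π) o′ o y)) →
  ExtremePointsIntegral P → ExtremePointsIntegral Q
relabel-transfers-integrality {m} {n} π o o′ {P} P⇒Q Q⇒P integralP y (Qy , extremeY) i j =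
  subst IsInteger (relabel-inverse (flip π) o′ o y i j)
        (relabel-integral π o o′ x (integralP x (Q⇒P y Qy , extremeX)) i j)
  where
    x : Array m n
    x = relabel (flip π) o′ o y
    extremeX : ∀ u v → P u → P v → (∀ i j → x i j ≡ (u i j ℚ.+ v i j) ℚ.* ½) → ∀ i j → u i j ≡ v i j
    extremeX u v Pu Pv x≡mid i j = begin
      u i j                                            ≡⟨ relabel-inverse π o o′ u i j ⟨
      relabel (flip π) o′ o (relabel π o o′ u) i j     ≡⟨ relabel-cong (flip π) o′ o _ _ images-equal i j ⟩
      relabel (flip π) o′ o (relabel π o o′ v) i j     ≡⟨ relabel-inverse π o o′ v i j ⟩
      v i j                                            ∎
      where
        open ≡-Reasoning
        images-equal : ∀ i j → relabel π o o′ u i j ≡ relabel π o o′ v i j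
        images-equal = extremeY _ _ (P⇒Q u Pu) (P⇒Q v Pv) λ i j →
          trans (sym (relabel-inverse (flip π) o′ o y i j)) (relabel-midpoint π o o′ x u v x≡mid i j)

-- Two blocks of indices

data Split (L : ℕ) : ℕ → Set where
  below  : ∀ {k} → k ℕ.< L → Split L k
  beyond : ∀ i → Split L (L ℕ.+ i)

split : ∀ L k → Split L k
split zero    k       = beyond k
split (suc L) zero    = below (s≤s z≤n)
split (suc L) (suc k) with split L k
... | below k<L = below (s≤s k<L)
... | beyond i  = beyond i

blockOffset : ℕ → ℕ → ℕ → ℕ
blockOffset a L k with split L k
... | below _  = a
... | beyond _ = 0

-- Index k in blocks of lengths N, L becomes index swapIndex L N k in blocks of lengths L, N.
swapIndex : ℕ → ℕ → ℕ → ℕ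
swapIndex L N k with split N k
... | below _  = L ℕ.+ k
... | beyond i = i

split-+ : ∀ L i → split L (L ℕ.+ i) ≡ beyond i
split-+ zero    i = refl
split-+ (suc L) i rewrite split-+ L i = refl

blockOffset-< : ∀ a {L k} → k ℕ.< L → blockOffset a L k ≡ a
blockOffset-< a {L} {k} k<L with split L k
... | below _  = refl
... | beyond i = contradiction k<L (ℕP.m+n≮m L i)

blockOffset-≥ : ∀ a {L k} → L ℕ.≤ k → blockOffset a L k ≡ 0
blockOffset-≥ a {L} {k} L≤k with split L k
... | below k<L = contradiction L≤k (ℕP.<⇒≱ k<L)
... | beyond _  = refl

swapIndex-< : ∀ L {N k} → k ℕ.< N → swapIndex L N k ≡ L ℕ.+ k
swapIndex-< L {N} {k} k<N with split N k
... | below _  = refl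
... | beyond i = contradiction k<N (ℕP.m+n≮m N i)

swapIndex-+ : ∀ L N i → swapIndex L N (N ℕ.+ i) ≡ i
swapIndex-+ L N i rewrite split-+ N i = refl

blockOffset-+ : ∀ a L i → blockOffset a L (L ℕ.+ i) ≡ 0
blockOffset-+ a L i rewrite split-+ L i = refl

blockOffset-suc : ∀ a {L k} → suc k ≢ L → blockOffset a L (suc k) ≡ blockOffset a L k
blockOffset-suc a {L} {k} 1+k≢L with split L k
... | below k<L = blockOffset-< a (ℕP.≤∧≢⇒< k<L 1+k≢L)
... | beyond i  = trans (cong (blockOffset a L) (sym (ℕP.+-suc L i))) (blockOffset-+ a L (suc i))

swapIndex-suc : ∀ L {N k} → suc k ≢ N → swapIndex L N (suc k) ≡ suc (swapIndex L N k)
swapIndex-suc L {N} {k} 1+k≢N with split N k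
... | below k<N = trans (swapIndex-< L (ℕP.≤∧≢⇒< k<N 1+k≢N)) (ℕP.+-suc L k)
... | beyond i  = trans (cong (swapIndex L N) (sym (ℕP.+-suc N i))) (swapIndex-+ L N (suc i))

swapIndex<L+N : ∀ L N {k} → k ℕ.< N ℕ.+ L → swapIndex L N k ℕ.< L ℕ.+ N
swapIndex<L+N L N {k} k<N+L with split N k
... | below k<N = ℕP.+-monoʳ-< L k<N
... | beyond i  = ℕP.<-≤-trans (ℕP.+-cancelˡ-< N i L k<N+L) (ℕP.m≤m+n L N)

swapIndex-involutive : ∀ L N {k} → k ℕ.< N ℕ.+ L → swapIndex N L (swapIndex L N k) ≡ k
swapIndex-involutive L N {k} k<N+L with split N k
... | below k<N = swapIndex-+ N L k
... | beyond i  = swapIndex-< N (ℕP.+-cancelˡ-< N i L k<N+L)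

1+swapIndex≢ : ∀ L N {k} → suc k ℕ.< N ℕ.+ L → suc (swapIndex L N k) ≢ L
1+swapIndex≢ L N {k} 1+k<N+L with split N k
... | below k<N = ℕP.m≢1+m+n L ∘ sym
... | beyond i  = ℕP.<⇒≢ (ℕP.+-cancelˡ-< N (suc i) L (subst (ℕ._< N ℕ.+ L) (sym (ℕP.+-suc N i)) 1+k<N+L))

at-++ˡ : ∀ xs ys {k} → k ℕ.< length xs → at (xs ++ ys) k ≡ at xs k
at-++ˡ (x ∷ xs) ys {zero}  _         = refl
at-++ˡ (x ∷ xs) ys {suc k} (s≤s k<) = at-++ˡ xs ys k<

at-++ʳ : ∀ xs ys i → at (xs ++ ys) (length xs ℕ.+ i) ≡ at ys i
at-++ʳ []       ys i = refl
at-++ʳ (x ∷ xs) ys i = at-++ʳ xs ys i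

at-++-congʳ : ∀ xs {ys zs} → (∀ k → at ys k ≡ at zs k) → ∀ k → at (xs ++ ys) k ≡ at (xs ++ zs) k
at-++-congʳ []       ys≗zs k       = ys≗zs k
at-++-congʳ (x ∷ xs) ys≗zs zero    = refl
at-++-congʳ (x ∷ xs) ys≗zs (suc k) = at-++-congʳ xs ys≗zs k

at-map : ∀ f xs {k} → k ℕ.< length xs → at (map f xs) k ≡ f (at xs k)
at-map f (x ∷ xs) {zero}  _        = refl
at-map f (x ∷ xs) {suc k} (s≤s k<) = at-map f xs k<

at-pad : ∀ xs n k → at (pad xs n) k ≡ at xs k
at-pad xs       zero    k       = refl
at-pad []       (suc n) zero    = refl
at-pad []       (suc n) (suc k) = at-pad [] n k
at-pad (x ∷ xs) (suc n) zero    = refl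
at-pad (x ∷ xs) (suc n) (suc k) = at-pad xs n k

length-pad : ∀ xs {n} → length xs ℕ.≤ n → length (pad xs n) ≡ n
length-pad []       {zero}  _         = refl
length-pad []       {suc n} _         = cong suc (length-pad [] z≤n)
length-pad (x ∷ xs) {suc n} (s≤s xs≤) = cong suc (length-pad xs xs≤)

at-++-swapIndex : ∀ P Q {L N k} → length P ≡ L → length Q ≡ N → k ℕ.< N ℕ.+ L →
                  at (P ++ Q) (swapIndex L N k) ≡ at (Q ++ P) k
at-++-swapIndex P Q {k = k} refl refl k<N+L with split (length Q) k
... | below k<N = trans (at-++ʳ P Q k) (sym (at-++ˡ Q P k<N))
... | beyond i  = trans (at-++ˡ P Q (ℕP.+-cancelˡ-< (length Q) i (length P) k<N+L)) (sym (at-++ʳ Q P i))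

-- Swapping the blocks of a disjoint union

-- unionOuter s t = stack ν₁ λ ν and unionInner s t = stack ν₁ (pad μ ℓ(λ)) τ.
stack : ℕ → List ℕ → List ℕ → List ℕ
stack a P Q = map (a ℕ.+_) P ++ Q

length-stack : ∀ a P Q → length (stack a P Q) ≡ length P ℕ.+ length Q
length-stack a P Q = trans (ListP.length-++ (map (a ℕ.+_) P)) (cong (ℕ._+ length Q) (ListP.length-map (a ℕ.+_) P))

at-stack : ∀ a P Q k → at (stack a P Q) k ≡ blockOffset a (length P) k ℕ.+ at (P ++ Q) k
at-stack a P Q k with split (length P) k
... | below k<L = begin
  at (map (a ℕ.+_) P ++ Q) k  ≡⟨ at-++ˡ (map (a ℕ.+_) P) Q
                                   (subst (k ℕ.<_) (sym (ListP.length-map (a ℕ.+_) P)) k<L) ⟩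
  at (map (a ℕ.+_) P) k       ≡⟨ at-map (a ℕ.+_) P k<L ⟩
  a ℕ.+ at P k                ≡⟨ cong (a ℕ.+_) (at-++ˡ P Q k<L) ⟨
  a ℕ.+ at (P ++ Q) k         ∎
  where open ≡-Reasoning
... | beyond i = begin
  at (map (a ℕ.+_) P ++ Q) (length P ℕ.+ i)                 ≡⟨ cong (λ l → at (map (a ℕ.+_) P ++ Q) (l ℕ.+ i))
                                                                    (ListP.length-map (a ℕ.+_) P) ⟨
  at (map (a ℕ.+_) P ++ Q) (length (map (a ℕ.+_) P) ℕ.+ i)  ≡⟨ at-++ʳ (map (a ℕ.+_) P) Q i ⟩
  at Q i                                                    ≡⟨ at-++ʳ P Q i ⟨
  at (P ++ Q) (length P ℕ.+ i)                              ∎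
  where open ≡-Reasoning

at-stack-pad : ∀ a R S {L} n k → length R ℕ.≤ L →
               at (stack a (pad R L) S) k ≡ blockOffset a L k ℕ.+ at (pad R L ++ pad S n) k
at-stack-pad a R S {L} n k R≤L =
  trans (at-stack a (pad R L) S k)
        (cong₂ ℕ._+_ (cong (λ l → blockOffset a l k) (length-pad R R≤L))
                     (at-++-congʳ (pad R L) (λ i → sym (at-pad S n i)) k))

at-stack-0 : ∀ a P Q → 0 ℕ.< length P → at (stack a P Q) 0 ≡ a ℕ.+ head0 P
at-stack-0 a (p ∷ P) Q _ = refl

toℕ<length-stack : ∀ a P Q (j : Fin (length (stack a P Q))) → toℕ j ℕ.< length P ℕ.+ length Q
toℕ<length-stack a P Q j = subst (toℕ j ℕ.<_) (length-stack a P Q) (FinP.toℕ<n j)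

swapColumn : ∀ a b P Q → Fin (length (stack b Q P)) → Fin (length (stack a P Q))
swapColumn a b P Q j = fromℕ< (subst (swapIndex (length P) (length Q) (toℕ j) ℕ.<_) (sym (length-stack a P Q))
                                     (swapIndex<L+N (length P) (length Q) (toℕ<length-stack b Q P j)))

toℕ-swapColumn : ∀ a b P Q j → toℕ (swapColumn a b P Q j) ≡ swapIndex (length P) (length Q) (toℕ j)
toℕ-swapColumn a b P Q j = FinP.toℕ-fromℕ< _

swapColumn-involutive : ∀ a b P Q j → swapColumn a b P Q (swapColumn b a Q P j) ≡ j
swapColumn-involutive a b P Q j = FinP.toℕ-injective (begin
  toℕ (swapColumn a b P Q (swapColumn b a Q P j))   ≡⟨ toℕ-swapColumn a b P Q _ ⟩
  swapIndex L N (toℕ (swapColumn b a Q P j))        ≡⟨ cong (swapIndex L N) (toℕ-swapColumn b a Q P j) ⟩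
  swapIndex L N (swapIndex N L (toℕ j))             ≡⟨ swapIndex-involutive N L (toℕ<length-stack a P Q j) ⟩
  toℕ j                                             ∎)
  where
    open ≡-Reasoning
    L = length P
    N = length Q

swapColumns : ∀ a b P Q → Permutation (length (stack b Q P)) (length (stack a P Q))
swapColumns a b P Q = permutation (swapColumn a b P Q) (swapColumn b a Q P)
                                  (swapColumn-involutive a b P Q) (swapColumn-involutive b a Q P)

stackOffset : ∀ a P Q → Fin (length (stack a P Q)) → ℕ
stackOffset a P Q j = blockOffset a (length P) (toℕ j)

stackSwap : ∀ a P Q {m} → Array m (length (stack a P Q)) → Array m (length (stack (head0 P) Q P))
stackSwap a P Q = relabel (swapColumns a (head0 P) P Q) (stackOffset a P Q) (stackOffset (head0 P) Q P)

increasing⇒first≤ : ∀ m (f : Fin (suc m) → ℚ) → (∀ i → f (inject₁ i) ℚ.≤ f (suc i)) →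
                    ∀ r → f zero ℚ.≤ f r
increasing⇒first≤ m       f up zero    = ℚP.≤-refl
increasing⇒first≤ (suc m) f up (suc r) =
  ℚP.≤-trans (increasing⇒first≤ m (λ i → f (inject₁ i)) (λ i → up (inject₁ i)) r) (up r)

increasing⇒≤last : ∀ m (f : Fin (suc m) → ℚ) → (∀ i → f (inject₁ i) ℚ.≤ f (suc i)) →
                   ∀ r → f r ℚ.≤ f (fromℕ m)
increasing⇒≤last zero    f up zero    = ℚP.≤-refl
increasing⇒≤last (suc m) f up zero    =
  ℚP.≤-trans (up zero) (increasing⇒≤last m (λ i → f (suc i)) (λ i → up (suc i)) zero)
increasing⇒≤last (suc m) f up (suc r) = increasing⇒≤last m (λ i → f (suc i)) (λ i → up (suc i)) r

module _ {α β w : List ℕ} {x : Array (suc (length w)) (length α)} (gt : InGT α β w x) where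
  open InGT gt

  bottom≤ : ∀ r j → x zero j ℚ.≤ x r j
  bottom≤ r j = increasing⇒first≤ (length w) (λ i → x i j) (λ i → up i j) r

  ≤top : ∀ r j → x r j ℚ.≤ x (fromℕ (length w)) j
  ≤top r j = increasing⇒≤last (length w) (λ i → x i j) (λ i → up i j) r

  0≤entry : ∀ r j → 0ℚ ℚ.≤ x r j
  0≤entry r j = ℚP.≤-trans (0≤ℕ→ℚ (at β (toℕ j)))
                           (ℚP.≤-trans (ℚP.≤-reflexive (sym (bot j))) (bottom≤ r j))

module _ (a : ℕ) (P Q : List ℕ) where
  private
    b L N : ℕ
    b = head0 P
    L = length P
    N = length Q
    π : Permutation (length (stack b Q P)) (length (stack a P Q))
    π = swapColumns a b P Q
    o : Fin (length (stack a P Q)) → ℕ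
    o = stackOffset a P Q
    o′ : Fin (length (stack b Q P)) → ℕ
    o′ = stackOffset b Q P

  stackSwap-row : ∀ {m} (x : Array m (length (stack a P Q))) r (R S : List ℕ) → length R ≡ L → length S ≡ N →
    (∀ j → x r j ≡ ℕ→ℚ (blockOffset a L (toℕ j) ℕ.+ at (R ++ S) (toℕ j))) →
    ∀ j → stackSwap a P Q x r j ≡ ℕ→ℚ (blockOffset b N (toℕ j) ℕ.+ at (S ++ R) (toℕ j))
  stackSwap-row x r R S R≡L S≡N row j =
    trans (relabel-fixedRow π o o′ x r (λ k → at (R ++ S) (toℕ k)) row j)
          (cong (λ d → ℕ→ℚ (o′ j ℕ.+ d))
                (trans (cong (at (R ++ S)) (toℕ-swapColumn a b P Q j))
                       (at-++-swapIndex R S R≡L S≡N (toℕ<length-stack b Q P j))))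

  module _ {P′ Q′ w : List ℕ} {x : Array (suc (length w)) (length (stack a P Q))}
           (gt : InGT (stack a P Q) (stack a (pad P′ L) Q′) w x) where
    open InGT gt

    private
      y : Array (suc (length w)) (length (stack b Q P))
      y = stackSwap a P Q x

    stackSwap-diag-inside : ∀ i j j′ → toℕ j′ ≡ suc (toℕ j) → toℕ j′ ≢ N →
                            y (suc i) j′ ℚ.≤ y (inject₁ i) j
    stackSwap-diag-inside i j j′ adj j′≢N =
      relabel-mono π o o′ x (diag i (π ⟨$⟩ʳ j) (π ⟨$⟩ʳ j′) π-adjacent)
                            (cong₂ (λ p q → + p ℤ.- + q) same-o′ same-o)
      where
        k = toℕ j
        1+k≢N : suc k ≢ N
        1+k≢N = subst (_≢ N) adj j′≢N
        1+k<N+L : suc k ℕ.< N ℕ.+ L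
        1+k<N+L = subst (ℕ._< N ℕ.+ L) adj (toℕ<length-stack b Q P j′)
        π-adjacent : toℕ (π ⟨$⟩ʳ j′) ≡ suc (toℕ (π ⟨$⟩ʳ j))
        π-adjacent = begin
          toℕ (π ⟨$⟩ʳ j′)          ≡⟨ toℕ-swapColumn a b P Q j′ ⟩
          swapIndex L N (toℕ j′)   ≡⟨ cong (swapIndex L N) adj ⟩
          swapIndex L N (suc k)    ≡⟨ swapIndex-suc L 1+k≢N ⟩
          suc (swapIndex L N k)    ≡⟨ cong suc (toℕ-swapColumn a b P Q j) ⟨
          suc (toℕ (π ⟨$⟩ʳ j))     ∎
          where open ≡-Reasoning
        same-o′ : o′ j′ ≡ o′ j
        same-o′ = trans (cong (blockOffset b N) adj) (blockOffset-suc b 1+k≢N)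
        same-o : o (π ⟨$⟩ʳ j′) ≡ o (π ⟨$⟩ʳ j)
        same-o = trans (cong (blockOffset a L) π-adjacent)
                       (blockOffset-suc a (subst (λ l → suc l ≢ L) (sym (toℕ-swapColumn a b P Q j))
                                                 (1+swapIndex≢ L N 1+k<N+L)))

    stackSwap-diag-boundary : ∀ i j j′ → toℕ j′ ≡ suc (toℕ j) → toℕ j′ ≡ N →
                              y (suc i) j′ ℚ.≤ y (inject₁ i) j
    stackSwap-diag-boundary i j j′ adj j′≡N = begin
      y (suc i) j′
        ≡⟨ cong (λ s → x (suc i) (π ⟨$⟩ʳ j′) ℚ.+ s ℚ./ 1) (cong₂ (λ p q → + p ℤ.- + q) o′j′≡0 oπj′≡a) ⟩
      x (suc i) (π ⟨$⟩ʳ j′) ℚ.+ (+ 0 ℤ.- + a) ℚ./ 1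
        ≤⟨ crossing-offsets a b upper (0≤entry gt (inject₁ i) (π ⟨$⟩ʳ j)) ⟩
      x (inject₁ i) (π ⟨$⟩ʳ j) ℚ.+ (+ b ℤ.- + 0) ℚ./ 1
        ≡⟨ cong (λ s → x (inject₁ i) (π ⟨$⟩ʳ j) ℚ.+ s ℚ./ 1) (cong₂ (λ p q → + p ℤ.- + q) o′j≡b oπj≡0) ⟨
      y (inject₁ i) j
        ∎
      where
        open ℚP.≤-Reasoning
        k = toℕ j
        k<N : k ℕ.< N
        k<N = subst (k ℕ.<_) (trans (sym adj) j′≡N) (ℕP.n<1+n k)
        0<L : 0 ℕ.< L
        0<L = ℕP.+-cancelˡ-< N 0 L (subst (ℕ._< N ℕ.+ L) (trans j′≡N (sym (ℕP.+-identityʳ N)))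
                                                      (toℕ<length-stack b Q P j′))
        πj′≡0 : toℕ (π ⟨$⟩ʳ j′) ≡ 0
        πj′≡0 = trans (toℕ-swapColumn a b P Q j′)
                      (trans (cong (swapIndex L N) (trans j′≡N (sym (ℕP.+-identityʳ N))))
                             (swapIndex-+ L N 0))
        o′j′≡0 : o′ j′ ≡ 0
        o′j′≡0 = trans (cong (blockOffset b N) j′≡N) (blockOffset-≥ b ℕP.≤-refl)
        oπj′≡a : o (π ⟨$⟩ʳ j′) ≡ a
        oπj′≡a = trans (cong (blockOffset a L) πj′≡0) (blockOffset-< a 0<L)
        o′j≡b : o′ j ≡ b
        o′j≡b = blockOffset-< b k<N
        oπj≡0 : o (π ⟨$⟩ʳ j) ≡ 0
        oπj≡0 = trans (cong (blockOffset a L) (trans (toℕ-swapColumn a b P Q j) (swapIndex-< L k<N)))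
                      (blockOffset-+ a L k)
        upper : x (suc i) (π ⟨$⟩ʳ j′) ℚ.≤ ℕ→ℚ (a ℕ.+ b)
        upper = ℚP.≤-trans (≤top gt (suc i) (π ⟨$⟩ʳ j′))
                  (ℚP.≤-reflexive (trans (top (π ⟨$⟩ʳ j′))
                    (cong ℕ→ℚ (trans (cong (at (stack a P Q)) πj′≡0) (at-stack-0 a P Q 0<L)))))

    stackSwap-diag : ∀ i j j′ → toℕ j′ ≡ suc (toℕ j) → y (suc i) j′ ℚ.≤ y (inject₁ i) j
    stackSwap-diag i j j′ adj with toℕ j′ ℕ.≟ N
    ... | yes j′≡N = stackSwap-diag-boundary i j j′ adj j′≡N
    ... | no  j′≢N = stackSwap-diag-inside i j j′ adj j′≢N

  stackSwap-InGT : ∀ {P′ Q′ w : List ℕ} {x : Array (suc (length w)) (length (stack a P Q))} →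
    length P′ ℕ.≤ L → length Q′ ℕ.≤ N → InGT (stack a P Q) (stack a (pad P′ L) Q′) w x →
    InGT (stack b Q P) (stack b (pad Q′ N) P′) w (stackSwap a P Q x)
  stackSwap-InGT {P′} {Q′} {w} {x} P′≤L Q′≤N gt = record
    { up   = λ i j → relabel-mono π o o′ x (up i (π ⟨$⟩ʳ j)) refl
    ; diag = stackSwap-diag gt
    ; top  = λ j → trans (stackSwap-row x (fromℕ (length w)) P Q refl refl top-row j)
                         (cong ℕ→ℚ (sym (at-stack b Q P (toℕ j))))
    ; bot  = λ j → trans (stackSwap-row x zero (pad P′ L) (pad Q′ N)
                                         (length-pad P′ P′≤L) (length-pad Q′ Q′≤N) bot-row j)
                         (cong ℕ→ℚ (sym (at-stack-pad b Q′ P′ L (toℕ j) Q′≤N)))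
    ; sums = λ i → trans (rowSum-relabel-difference π o o′ x (suc i) (inject₁ i)) (sums i)
    }
    where
      open InGT gt
      top-row : ∀ j → x (fromℕ (length w)) j ≡ ℕ→ℚ (blockOffset a L (toℕ j) ℕ.+ at (P ++ Q) (toℕ j))
      top-row j = trans (top j) (cong ℕ→ℚ (at-stack a P Q (toℕ j)))
      bot-row : ∀ j → x zero j ≡ ℕ→ℚ (blockOffset a L (toℕ j) ℕ.+ at (pad P′ L ++ pad Q′ N) (toℕ j))
      bot-row j = trans (bot j) (cong ℕ→ℚ (at-stack-pad a P′ Q′ N (toℕ j) P′≤L))

integral-swap : (s t : SkewShape) (w : List ℕ) →
  IsIntegral (unionOuter s t) (unionInner s t) w → IsIntegral (unionOuter t s) (unionInner t s) w
integral-swap s t w =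
  relabel-transfers-integrality (swapColumns a b λ′ ν) (stackOffset a λ′ ν) (stackOffset b ν λ′)
    (λ _ → stackSwap-InGT a λ′ ν (innerShorter s) (innerShorter t))
    (λ _ → stackSwap-InGT b ν λ′ (innerShorter t) (innerShorter s))
  where
    λ′ = outer s
    ν = outer t
    a = head0 ν
    b = head0 λ′

mainTheorem12 : (s t : SkewShape) (w : List ℕ) →
    IsIntegral (unionOuter s t) (unionInner s t) w ⇔ IsIntegral (unionOuter t s) (unionInner t s) w
mainTheorem12 s t w = mk⇔ (integral-swap s t w) (integral-swap t s w)
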